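{- Let $G$ be a finite simple graph. If $\emptyset\neq\Gamma'\subseteq\mathrm{MaxCritIndep}(G)$ and $\emptyset\neq\Gamma\subseteq\Omega(G)$, then \[ \left|\bigcap\Gamma'\right|+\left|\bigcup\Gamma'\right|\leq 2\alpha'(G)\leq 2\alpha(G)\leq\left|\bigcap\Gamma\right|+\left|\bigcup\Gamma\right|. \]
   Context: For a graph $G$ and $A\subseteq V(G)$: $N(A)=\{v\in V(G): v \text{ has a neighbor in } A\}$. A set is independent if no two of its vertices are adjacent; $\mathrm{Ind}(G)$ is the family of independent sets, $\alpha(G)$ the maximum size of an independent set, and $\Omega(G)$ the family of all maximum independent sets. The difference of $X\subseteq V(G)$ is $d(X)=|X|-|N(X)|$. An independent set $A$ is critical if $d(A)=\max\{d(I):I\in\mathrm{Ind}(G)\}$. A maximum critical independent set is a critical independent set of maximum cardinality among all critical independent sets; $\mathrm{MaxCritIndep}(G)$ denotes the family of all of them. The critical independence number $\alpha'(G)$ is the maximum cardinality of a critical independent set of $G$. -}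

module Defs where

open import Data.Bool using (Bool; true; false)
import Data.Bool as B
open import Data.Nat using (ℕ; zero; suc; _⊔_)
open import Data.Integer using (ℤ; +_; _-_; _≤_)
import Data.Integer as Int
open import Data.Fin using (Fin)
open import Data.Fin.Properties using (all?; any?)
open import Data.Fin.Subset using (Subset; _∈_; ∣_∣; inside; outside)
open import Data.Fin.Subset.Properties using (_∈?_)
open import Data.Vec using (Vec; []; _∷_; tabulate)
open import Data.List using (List; []; _∷_; _++_; map; filter; foldr)
open import Data.Product using (_×_; _,_; ∃)
open import Relation.Binary.PropositionalEquality using (_≡_)
open import Relation.Nullary using (Dec; yes; no; does)
open import Relation.Nullary.Decidable using (_×-dec_; _→-dec_)
open import Relation.Unary using (Pred; Decidable)

record Graph (n : ℕ) : Set where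
  field
    adj    : Fin n → Fin n → Bool
    sym    : ∀ u v → adj u v ≡ adj v u
    irrefl : ∀ v → adj v v ≡ false
open Graph public

module _ {n : ℕ} (G : Graph n) where

  N : Subset n → Subset n
  N A = tabulate λ v → does (any? λ u → (u ∈? A) ×-dec (adj G u v B.≟ true))

  d : Subset n → ℤ
  d X = + ∣ X ∣ - + ∣ N X ∣

  Independent : Subset n → Set
  Independent A = ∀ u v → u ∈ A → v ∈ A → adj G u v ≡ false

  MaximumIndependent : Subset n → Set
  MaximumIndependent A = Independent A × (∀ B → Independent B → ∣ B ∣ Data.Nat.≤ ∣ A ∣)

  Critical : Subset n → Set
  Critical A = Independent A × (∀ I → Independent I → d I ≤ d A)

  MaxCritIndep : Subset n → Set
  MaxCritIndep A = Critical A × (∀ B → Critical B → ∣ B ∣ Data.Nat.≤ ∣ A ∣)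

allSubsets : (n : ℕ) → List (Subset n)
allSubsets zero    = [] ∷ []
allSubsets (suc n) = map (inside ∷_) (allSubsets n) ++ map (outside ∷_) (allSubsets n)

∀Subset? : ∀ {n} {P : Subset n → Set} → Decidable P → Dec (∀ s → P s)
∀Subset? {zero} P? with P? []
... | yes p = yes λ { [] → p }
... | no ¬p = no λ h → ¬p (h [])
∀Subset? {suc n} {P} P? with ∀Subset? (λ s → P? (inside ∷ s)) | ∀Subset? (λ s → P? (outside ∷ s))
... | yes p | yes q = yes λ { (true ∷ s) → p s ; (false ∷ s) → q s }
... | no ¬p | _     = no λ h → ¬p (λ s → h (inside ∷ s))
... | yes _ | no ¬q = no λ h → ¬q (λ s → h (outside ∷ s))

-- maximum cardinality of a subset satisfying a decidable predicate (0 if none)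
maxCard : ∀ {n} {P : Subset n → Set} → Decidable P → ℕ
maxCard {n} P? = foldr (λ A m → ∣ A ∣ ⊔ m) 0 (filter P? (allSubsets n))

module _ {n : ℕ} (G : Graph n) where

  independent? : Decidable (Independent G)
  independent? A = all? λ u → all? λ v → (u ∈? A) →-dec (v ∈? A) →-dec (adj G u v B.≟ false)

  critical? : Decidable (Critical G)
  critical? A = independent? A ×-dec ∀Subset? (λ I → independent? I →-dec (d G I Int.≤? d G A))

  α : ℕ
  α = maxCard independent?

  α′ : ℕ
  α′ = maxCard critical?

module Submission where

-- The proof rests on four facts:
--   * exchange: N is submodular, hence d(A ∩ B) ≤ d(B) implies d(A) ≤ d(A ∪ B);
--   * core: for any Z, the set core Z = Z - N(Z) is independent and d(Z) ≤ d(core Z);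
--   * Hall-type inequality: if T is critical and B ⊆ N(T), then |B| ≤ |T ∩ N(B)|;
--   * closure: if T, T' are maximum critical, then T' ⊆ T ∪ N(T), since otherwise
--     T ∪ core(T ∪ T') is a strictly larger critical independent set.
-- Upper bound: for T ∈ Γ', put X = ⋂Γ', Y = ⋃Γ'.  By closure Y - T ⊆ N(T), and no vertex of X
-- is adjacent to Y, so Hall gives |Y - T| ≤ |T - X|, i.e. |X| + |Y| ≤ 2|T| = 2α'.
-- Lower bound: if T is maximum independent and X is independent with no edges to Y, then
-- X ∪ (T ∩ Y) is independent, which yields |X| + |Y| ≤ |T ∩ X| + |T ∪ Y|; adding the sets of Γ
-- one at a time shows 2α ≤ |⋂Γ| + |⋃Γ|.  Finally α' ≤ α as critical sets are independent.

open import Defs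
open import Data.Nat using (ℕ; _+_; _*_; _≤_)
open import Data.Fin.Subset using (Subset; ⋂; ⋃; ∣_∣)
open import Data.List using (List; [])
open import Data.List.Relation.Unary.All using (All)
open import Data.Product using (_×_)
open import Relation.Binary.PropositionalEquality using (_≢_)

open import Data.Nat using (suc; _<_; _⊔_; z≤n)
open import Data.Nat.Properties
  using (+-suc; +-assoc; +-identityʳ; +-mono-≤; +-monoˡ-≤; +-monoʳ-≤; +-cancelˡ-≤; +-cancelʳ-≤;
         ≤-trans; ≤-reflexive; ≤-antisym; <⇒≱; *-monoʳ-≤; m≤m⊔n; m≤n⇒m≤o⊔n; ⊔-lub;
         module ≤-Reasoning)
open import Data.Nat.Solver using (module +-*-Solver)
open import Data.Bool using (true; false; _≟_)
open import Data.Bool.Properties using (¬-not)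
open import Data.Fin using (Fin)
open import Data.Fin.Properties using (any?)
open import Data.Fin.Subset using (_∈_; _∉_; _⊆_; _∪_; _∩_; _─_; ⊥; inside; outside)
open import Data.Fin.Subset.Properties
  using (_∈?_; p⊆q⇒∣p∣≤∣q∣; p⊂q⇒∣p∣<∣q∣; ∣⊥∣≡0; ∉⊥; x∈p∩q⁺; x∈p∩q⁻; x∈p∪q⁺; x∈p∪q⁻;
         p∩q⊆p; p∩q⊆q; p⊆p∪q; q⊆p∪q; p─q⊆p; x∈p∧x∉q⇒x∈p─q; ∩-identityʳ; ∪-identityʳ)
open import Data.Vec using ([]; _∷_; here; there; tabulate)
open import Data.Vec.Properties using ([]=⇒lookup; lookup⇒[]=; lookup∘tabulate)
open import Data.List using (_∷_; map; foldr; filter)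
import Data.List.Membership.Propositional as List
open import Data.List.Membership.Propositional.Properties
  using (∈-filter⁺; ∈-filter⁻; ∈-++⁺ˡ; ∈-++⁺ʳ; ∈-map⁺)
open import Data.List.Relation.Unary.Any using (Any; here; there)
import Data.List.Relation.Unary.All as All
open import Data.Product using (_,_; proj₁; proj₂; ∃; uncurry)
open import Data.Sum using (inj₁; inj₂)
open import Data.Empty using (⊥-elim) renaming (⊥ to Empty)
open import Function using (_∘_)
open import Relation.Nullary using (Dec; yes; no; does)
open import Relation.Nullary.Decidable using (dec-true; _×-dec_)
open import Relation.Unary using (Decidable)
open import Relation.Binary.PropositionalEquality
  using (_≡_; refl; trans; cong; cong₂; subst₂)
  renaming (sym to ≡-sym)
import Data.Integer as ℤ
open import Data.Integer using (+_)
import Data.Integer.Properties as ℤ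
import Data.Integer.Solver as ℤ-Solver

diff-≤⇒cross-≤ : ∀ {a b c e} → + a ℤ.- + b ℤ.≤ + c ℤ.- + e → a + e ≤ c + b
diff-≤⇒cross-≤ {a} {b} {c} {e} h = ℤ.drop‿+≤+ (subst₂ ℤ._≤_
  (trans (solve 3 (λ x y z → (x :- y) :+ (y :+ z) := x :+ z) refl (+ a) (+ b) (+ e)) (≡-sym (ℤ.pos-+ a e)))
  (trans (solve 3 (λ x y z → (x :- z) :+ (y :+ z) := x :+ y) refl (+ c) (+ b) (+ e)) (≡-sym (ℤ.pos-+ c b)))
  (ℤ.+-monoˡ-≤ (+ b ℤ.+ + e) h))
  where open ℤ-Solver.+-*-Solver

cross-≤⇒diff-≤ : ∀ {a b c e} → a + e ≤ c + b → + a ℤ.- + b ℤ.≤ + c ℤ.- + e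
cross-≤⇒diff-≤ {a} {b} {c} {e} h = subst₂ ℤ._≤_
  (solve 3 (λ x y z → (x :+ z) :- (y :+ z) := x :- y) refl (+ a) (+ b) (+ e))
  (solve 3 (λ x y z → (x :+ y) :- (y :+ z) := x :- z) refl (+ c) (+ b) (+ e))
  (ℤ.+-monoˡ-≤ (ℤ.- (+ b ℤ.+ + e)) (subst₂ ℤ._≤_ (ℤ.pos-+ a e) (ℤ.pos-+ c b) (ℤ.+≤+ h)))
  where open ℤ-Solver.+-*-Solver

-- Read cU, cI, cA, cB as the sizes of A ∪ B, A ∩ B,
-- A, B and nU, nI, nA, nB as the sizes of their neighbourhoods: modularity of sizes and
-- submodularity of neighbourhoods turn d(A ∩ B) ≤ d(B) into d(A) ≤ d(A ∪ B).
exchange-arithmetic : ∀ {cU cI cA cB nU nI nA nB} →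
  cU + cI ≡ cA + cB → nU + nI ≤ nA + nB → cI + nB ≤ cB + nI → cA + nU ≤ cU + nA
exchange-arithmetic {cU} {cI} {cA} {cB} {nU} {nI} {nA} {nB} modular submodular h =
  +-cancelˡ-≤ (cB + nI) _ _ (begin
    cB + nI + (cA + nU)   ≡⟨ solve 4 (λ cB nI cA nU → cB :+ nI :+ (cA :+ nU) := (cA :+ cB) :+ (nU :+ nI)) refl cB nI cA nU ⟩
    (cA + cB) + (nU + nI) ≡⟨ cong (_+ (nU + nI)) (≡-sym modular) ⟩
    (cU + cI) + (nU + nI) ≤⟨ +-monoʳ-≤ (cU + cI) submodular ⟩
    (cU + cI) + (nA + nB) ≡⟨ solve 4 (λ cU cI nA nB → (cU :+ cI) :+ (nA :+ nB) := (cI :+ nB) :+ (cU :+ nA)) refl cU cI nA nB ⟩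
    (cI + nB) + (cU + nA) ≤⟨ +-monoˡ-≤ (cU + nA) h ⟩
    (cB + nI) + (cU + nA) ∎)
  where open ≤-Reasoning
        open +-*-Solver

∣p∪q∣+∣p∩q∣≡∣p∣+∣q∣ : ∀ {n} (p q : Subset n) → ∣ p ∪ q ∣ + ∣ p ∩ q ∣ ≡ ∣ p ∣ + ∣ q ∣
∣p∪q∣+∣p∩q∣≡∣p∣+∣q∣ []            []            = refl
∣p∪q∣+∣p∩q∣≡∣p∣+∣q∣ (inside  ∷ p) (inside  ∷ q) =
  cong suc (trans (+-suc _ _) (trans (cong suc (∣p∪q∣+∣p∩q∣≡∣p∣+∣q∣ p q)) (≡-sym (+-suc _ _))))
∣p∪q∣+∣p∩q∣≡∣p∣+∣q∣ (inside  ∷ p) (outside ∷ q) = cong suc (∣p∪q∣+∣p∩q∣≡∣p∣+∣q∣ p q)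
∣p∪q∣+∣p∩q∣≡∣p∣+∣q∣ (outside ∷ p) (inside  ∷ q) =
  trans (cong suc (∣p∪q∣+∣p∩q∣≡∣p∣+∣q∣ p q)) (≡-sym (+-suc _ _))
∣p∪q∣+∣p∩q∣≡∣p∣+∣q∣ (outside ∷ p) (outside ∷ q) = ∣p∪q∣+∣p∩q∣≡∣p∣+∣q∣ p q

∣p─q∣+∣p∩q∣≡∣p∣ : ∀ {n} (p q : Subset n) → ∣ p ─ q ∣ + ∣ p ∩ q ∣ ≡ ∣ p ∣
∣p─q∣+∣p∩q∣≡∣p∣ []            []            = refl
∣p─q∣+∣p∩q∣≡∣p∣ (inside  ∷ p) (inside  ∷ q) = trans (+-suc _ _) (cong suc (∣p─q∣+∣p∩q∣≡∣p∣ p q))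
∣p─q∣+∣p∩q∣≡∣p∣ (inside  ∷ p) (outside ∷ q) = cong suc (∣p─q∣+∣p∩q∣≡∣p∣ p q)
∣p─q∣+∣p∩q∣≡∣p∣ (outside ∷ p) (inside  ∷ q) = ∣p─q∣+∣p∩q∣≡∣p∣ p q
∣p─q∣+∣p∩q∣≡∣p∣ (outside ∷ p) (outside ∷ q) = ∣p─q∣+∣p∩q∣≡∣p∣ p q

x∈p─q⇒x∉q : ∀ {n} {x : Fin n} (p q : Subset n) → x ∈ p ─ q → x ∉ q
x∈p─q⇒x∉q (inside ∷ p) (outside ∷ q) here      ()
x∈p─q⇒x∉q (_      ∷ p) (_       ∷ q) (there h) (there h′) = x∈p─q⇒x∉q p q h h′

∣q─p∣+∣p∣≡∣q∣ : ∀ {n} {p q : Subset n} → p ⊆ q → ∣ q ─ p ∣ + ∣ p ∣ ≡ ∣ q ∣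
∣q─p∣+∣p∣≡∣q∣ {p = p} {q} p⊆q = trans (cong (λ k → ∣ q ─ p ∣ + k) ∣q∩p∣≡∣p∣) (∣p─q∣+∣p∩q∣≡∣p∣ q p)
  where
    ∣q∩p∣≡∣p∣ : ∣ p ∣ ≡ ∣ q ∩ p ∣
    ∣q∩p∣≡∣p∣ = ≤-antisym (p⊆q⇒∣p∣≤∣q∣ (λ x∈p → x∈p∩q⁺ (p⊆q x∈p , x∈p)))
                          (p⊆q⇒∣p∣≤∣q∣ (proj₂ ∘ x∈p∩q⁻ q p))

disjoint-⊆⇒∣p∣+∣q∣≤∣r∣ : ∀ {n} {p q r : Subset n} → (∀ {x} → x ∈ p → x ∈ q → Empty) →
  p ⊆ r → q ⊆ r → ∣ p ∣ + ∣ q ∣ ≤ ∣ r ∣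
disjoint-⊆⇒∣p∣+∣q∣≤∣r∣ {n} {p} {q} {r} disjoint p⊆r q⊆r = begin
  ∣ p ∣ + ∣ q ∣         ≡⟨ ≡-sym (∣p∪q∣+∣p∩q∣≡∣p∣+∣q∣ p q) ⟩
  ∣ p ∪ q ∣ + ∣ p ∩ q ∣ ≤⟨ +-mono-≤ (p⊆q⇒∣p∣≤∣q∣ p∪q⊆r) ∣p∩q∣≤0 ⟩
  ∣ r ∣ + 0             ≡⟨ +-identityʳ ∣ r ∣ ⟩
  ∣ r ∣                 ∎
  where
    open ≤-Reasoning
    p∪q⊆r : p ∪ q ⊆ r
    p∪q⊆r x∈p∪q with x∈p∪q⁻ p q x∈p∪q
    ... | inj₁ x∈p = p⊆r x∈p
    ... | inj₂ x∈q = q⊆r x∈q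
    ∣p∩q∣≤0 : ∣ p ∩ q ∣ ≤ 0
    ∣p∩q∣≤0 = ≤-trans (p⊆q⇒∣p∣≤∣q∣ {q = ⊥} (λ x∈p∩q → ⊥-elim (uncurry disjoint (x∈p∩q⁻ p q x∈p∩q))))
                      (≤-reflexive (∣⊥∣≡0 n))

∈⋂⁻ : ∀ {n} {x : Fin n} (Γ : List (Subset n)) → x ∈ ⋂ Γ → All (x ∈_) Γ
∈⋂⁻ []      _     = All.[]
∈⋂⁻ (S ∷ Γ) x∈⋂Γ = let x∈S , x∈⋂ = x∈p∩q⁻ S (⋂ Γ) x∈⋂Γ in x∈S All.∷ ∈⋂⁻ Γ x∈⋂

∈⋃⁻ : ∀ {n} {x : Fin n} (Γ : List (Subset n)) → x ∈ ⋃ Γ → Any (x ∈_) Γ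
∈⋃⁻ []      x∈⊥ = ⊥-elim (∉⊥ x∈⊥)
∈⋃⁻ (S ∷ Γ) x∈⋃Γ with x∈p∪q⁻ S (⋃ Γ) x∈⋃Γ
... | inj₁ x∈S = here x∈S
... | inj₂ x∈⋃ = there (∈⋃⁻ Γ x∈⋃)

allSubsets-complete : ∀ {n} (s : Subset n) → s List.∈ allSubsets n
allSubsets-complete []                  = here refl
allSubsets-complete {suc n} (inside ∷ s) = ∈-++⁺ˡ (∈-map⁺ (inside ∷_) (allSubsets-complete s))
allSubsets-complete {suc n} (outside ∷ s) =
  ∈-++⁺ʳ (map (inside ∷_) (allSubsets n)) (∈-map⁺ (outside ∷_) (allSubsets-complete s))

maxCard-lub : ∀ {n} {P : Subset n → Set} (P? : Decidable P) k →
  (∀ A → P A → ∣ A ∣ ≤ k) → maxCard P? ≤ k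
maxCard-lub {n} P? k bound =
  go (filter P? (allSubsets n)) (λ A∈ → bound _ (proj₂ (∈-filter⁻ P? {xs = allSubsets n} A∈)))
  where
    go : ∀ xs → (∀ {A} → A List.∈ xs → ∣ A ∣ ≤ k) → foldr (λ A m → ∣ A ∣ ⊔ m) 0 xs ≤ k
    go []       _     = z≤n
    go (A ∷ xs) bound = ⊔-lub (bound (here refl)) (go xs (bound ∘ there))

maxCard-ub : ∀ {n} {P : Subset n → Set} (P? : Decidable P) A → P A → ∣ A ∣ ≤ maxCard P?
maxCard-ub {n} P? A pA = go (filter P? (allSubsets n)) (∈-filter⁺ P? (allSubsets-complete A) pA)
  where
    go : ∀ xs → A List.∈ xs → ∣ A ∣ ≤ foldr (λ A m → ∣ A ∣ ⊔ m) 0 xs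
    go (B ∷ xs) (here refl) = m≤m⊔n _ _
    go (B ∷ xs) (there A∈)  = m≤n⇒m≤o⊔n ∣ B ∣ (go xs A∈)

maxCard-attained : ∀ {n} {P : Subset n → Set} (P? : Decidable P) A →
  P A → (∀ B → P B → ∣ B ∣ ≤ ∣ A ∣) → maxCard P? ≡ ∣ A ∣
maxCard-attained P? A pA largest = ≤-antisym (maxCard-lub P? ∣ A ∣ largest) (maxCard-ub P? A pA)

does-true⇒witness : ∀ {P : Set} (P? : Dec P) → does P? ≡ true → P
does-true⇒witness (yes p) _  = p
does-true⇒witness (no _)  ()

module _ {n : ℕ} (G : Graph n) where

  neighbour? : ∀ A v → Dec (∃ λ u → u ∈ A × adj G u v ≡ true)
  neighbour? A v = any? λ u → (u ∈? A) ×-dec (adj G u v ≟ true)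

  ∈N⁺ : ∀ {A u v} → u ∈ A → adj G u v ≡ true → v ∈ N G A
  ∈N⁺ {A} {u} {v} u∈A uv =
    lookup⇒[]= v (N G A) (trans (lookup∘tabulate (does ∘ neighbour? A) v)
                                (dec-true (neighbour? A v) (u , u∈A , uv)))

  ∈N⁻ : ∀ {A v} → v ∈ N G A → ∃ λ u → u ∈ A × adj G u v ≡ true
  ∈N⁻ {A} {v} v∈NA = does-true⇒witness (neighbour? A v)
    (trans (≡-sym (lookup∘tabulate (does ∘ neighbour? A) v)) ([]=⇒lookup v∈NA))

  N-mono : ∀ {A B} → A ⊆ B → N G A ⊆ N G B
  N-mono A⊆B v∈NA = let u , u∈A , uv = ∈N⁻ v∈NA in ∈N⁺ (A⊆B u∈A) uv

  N-submodular : ∀ A B → ∣ N G (A ∪ B) ∣ + ∣ N G (A ∩ B) ∣ ≤ ∣ N G A ∣ + ∣ N G B ∣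
  N-submodular A B = begin
    ∣ N G (A ∪ B) ∣ + ∣ N G (A ∩ B) ∣     ≤⟨ +-mono-≤ (p⊆q⇒∣p∣≤∣q∣ N∪⊆∪N) (p⊆q⇒∣p∣≤∣q∣ N∩⊆∩N) ⟩
    ∣ N G A ∪ N G B ∣ + ∣ N G A ∩ N G B ∣ ≡⟨ ∣p∪q∣+∣p∩q∣≡∣p∣+∣q∣ (N G A) (N G B) ⟩
    ∣ N G A ∣ + ∣ N G B ∣                 ∎
    where
      open ≤-Reasoning
      N∪⊆∪N : N G (A ∪ B) ⊆ N G A ∪ N G B
      N∪⊆∪N v∈N with ∈N⁻ v∈N
      ... | u , u∈A∪B , uv with x∈p∪q⁻ A B u∈A∪B
      ... | inj₁ u∈A = x∈p∪q⁺ (inj₁ (∈N⁺ u∈A uv))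
      ... | inj₂ u∈B = x∈p∪q⁺ (inj₂ (∈N⁺ u∈B uv))
      N∩⊆∩N : N G (A ∩ B) ⊆ N G A ∩ N G B
      N∩⊆∩N v∈N = x∈p∩q⁺ (N-mono (p∩q⊆p A B) v∈N , N-mono (proj₂ ∘ x∈p∩q⁻ A B) v∈N)

  NoEdges : Subset n → Subset n → Set
  NoEdges X Y = ∀ x y → x ∈ X → y ∈ Y → adj G x y ≡ false

  no-edge : ∀ {u v} → adj G u v ≡ false → adj G u v ≡ true → Empty
  no-edge u≁v u∼v with () ← trans (≡-sym u≁v) u∼v

  -- Adjacency is Boolean, so excluding edges suffices.
  NoEdges⁺ : ∀ {X Y} → (∀ {x y} → x ∈ X → y ∈ Y → adj G x y ≡ true → Empty) → NoEdges X Y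
  NoEdges⁺ no-adj x y x∈X y∈Y = ¬-not (no-adj x∈X y∈Y)

  NoEdges-sym : ∀ {X Y} → NoEdges X Y → NoEdges Y X
  NoEdges-sym noEdges y x y∈Y x∈X = trans (Graph.sym G y x) (noEdges x y x∈X y∈Y)

  NoEdges-⊆ : ∀ {X X′ Y Y′} → X′ ⊆ X → Y′ ⊆ Y → NoEdges X Y → NoEdges X′ Y′
  NoEdges-⊆ X′⊆X Y′⊆Y noEdges x y x∈X′ y∈Y′ = noEdges x y (X′⊆X x∈X′) (Y′⊆Y y∈Y′)

  ∪-independent : ∀ {A B} → Independent G A → Independent G B → NoEdges A B →
    Independent G (A ∪ B)
  ∪-independent {A} {B} indA indB noEdges u v u∈A∪B v∈A∪B
    with x∈p∪q⁻ A B u∈A∪B | x∈p∪q⁻ A B v∈A∪B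
  ... | inj₁ u∈A | inj₁ v∈A = indA u v u∈A v∈A
  ... | inj₁ u∈A | inj₂ v∈B = noEdges u v u∈A v∈B
  ... | inj₂ u∈B | inj₁ v∈A = NoEdges-sym noEdges u v u∈B v∈A
  ... | inj₂ u∈B | inj₂ v∈B = indB u v u∈B v∈B

  ⋂-⋃-NoEdges : ∀ {Γ} → All (Independent G) Γ → NoEdges (⋂ Γ) (⋃ Γ)
  ⋂-⋃-NoEdges {Γ} indΓ x y x∈⋂ y∈⋃ =
    let (indS , x∈S) , y∈S = All.lookupAny (All.zip (indΓ , ∈⋂⁻ Γ x∈⋂)) (∈⋃⁻ Γ y∈⋃)
    in indS x y x∈S y∈S

  ⊆-independent : ∀ {A B} → A ⊆ B → Independent G B → Independent G A
  ⊆-independent A⊆B = NoEdges-⊆ A⊆B A⊆B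

  -- A ≼ B states d(A) ≤ d(B), with the subtractions cleared.
  infix 4 _≼_
  _≼_ : Subset n → Subset n → Set
  A ≼ B = ∣ A ∣ + ∣ N G B ∣ ≤ ∣ B ∣ + ∣ N G A ∣

  d-≤⇒≼ : ∀ {A B} → d G A ℤ.≤ d G B → A ≼ B
  d-≤⇒≼ {A} {B} = diff-≤⇒cross-≤ {∣ A ∣} {∣ N G A ∣} {∣ B ∣} {∣ N G B ∣}

  ≼⇒d-≤ : ∀ {A B} → A ≼ B → d G A ℤ.≤ d G B
  ≼⇒d-≤ {A} {B} = cross-≤⇒diff-≤ {∣ A ∣} {∣ N G A ∣} {∣ B ∣} {∣ N G B ∣}

  ≼-trans : ∀ {A B C} → A ≼ B → B ≼ C → A ≼ C
  ≼-trans {A} {B} {C} A≼B B≼C = d-≤⇒≼ {A} {C} (ℤ.≤-trans (≼⇒d-≤ {A} {B} A≼B) (≼⇒d-≤ {B} {C} B≼C))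

  critical⇒≼ : ∀ {T J} → Critical G T → Independent G J → J ≼ T
  critical⇒≼ (_ , maximal) indJ = d-≤⇒≼ (maximal _ indJ)

  -- Exchange: by submodularity of N, d(A ∩ B) ≤ d(B) implies d(A) ≤ d(A ∪ B).
  ≼-exchange : ∀ {A B} → A ∩ B ≼ B → A ≼ A ∪ B
  ≼-exchange {A} {B} = exchange-arithmetic {∣ A ∪ B ∣} {∣ A ∩ B ∣} {∣ A ∣} {∣ B ∣}
    {∣ N G (A ∪ B) ∣} {∣ N G (A ∩ B) ∣} {∣ N G A ∣} {∣ N G B ∣}
    (∣p∪q∣+∣p∩q∣≡∣p∣+∣q∣ A B) (N-submodular A B)

  core : Subset n → Subset n
  core Z = Z ─ N G Z

  core-NoEdges : ∀ {A Z} → A ⊆ Z → NoEdges A (core Z)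
  core-NoEdges {Z = Z} A⊆Z = NoEdges⁺ λ u∈A v∈core uv →
    x∈p─q⇒x∉q Z (N G Z) v∈core (∈N⁺ (A⊆Z u∈A) uv)

  core-independent : ∀ Z → Independent G (core Z)
  core-independent Z = core-NoEdges (p─q⊆p Z (N G Z))

  -- Passing to the core does not decrease d: the removed vertices Z ∩ N(Z) and the
  -- neighbourhood of the core are disjoint parts of N(Z).
  ≼-core : ∀ Z → Z ≼ core Z
  ≼-core Z = begin
    ∣ Z ∣ + ∣ N G I ∣           ≡⟨ cong (λ k → k + ∣ N G I ∣) (≡-sym (∣p─q∣+∣p∩q∣≡∣p∣ Z (N G Z))) ⟩
    ∣ I ∣ + ∣ C ∣ + ∣ N G I ∣   ≡⟨ +-assoc (∣ I ∣) (∣ C ∣) (∣ N G I ∣) ⟩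
    ∣ I ∣ + (∣ C ∣ + ∣ N G I ∣) ≤⟨ +-monoʳ-≤ ∣ I ∣ C,NI⊆NZ ⟩
    ∣ I ∣ + ∣ N G Z ∣           ∎
    where
      open ≤-Reasoning
      I C : Subset n
      I = core Z
      C = Z ∩ N G Z
      disjoint : ∀ {x} → x ∈ C → x ∈ N G I → Empty
      disjoint {x} x∈C x∈NI = let c , c∈I , cx = ∈N⁻ x∈NI in
        no-edge (core-NoEdges (p∩q⊆p Z (N G Z)) x c x∈C c∈I) (trans (Graph.sym G x c) cx)
      C,NI⊆NZ : ∣ C ∣ + ∣ N G I ∣ ≤ ∣ N G Z ∣
      C,NI⊆NZ = disjoint-⊆⇒∣p∣+∣q∣≤∣r∣ disjoint (p∩q⊆q Z (N G Z)) (N-mono (p─q⊆p Z (N G Z)))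

  -- Hall-type inequality: a critical T has at least |B| vertices adjacent to any B ⊆ N(T).
  -- Compare T with the independent set T′ = T ─ N(B), whose neighbourhood misses B.
  hall : ∀ {T B} → Critical G T → B ⊆ N G T → ∣ B ∣ ≤ ∣ T ∩ N G B ∣
  hall {T} {B} critT B⊆NT = +-cancelˡ-≤ (∣ T′ ∣ + ∣ N G T′ ∣) _ _ (begin
    ∣ T′ ∣ + ∣ N G T′ ∣ + ∣ B ∣                 ≡⟨ +-assoc (∣ T′ ∣) (∣ N G T′ ∣) (∣ B ∣) ⟩
    ∣ T′ ∣ + (∣ N G T′ ∣ + ∣ B ∣)               ≤⟨ +-monoʳ-≤ ∣ T′ ∣ NT′,B⊆NT ⟩
    ∣ T′ ∣ + ∣ N G T ∣                          ≤⟨ critical⇒≼ critT (⊆-independent T′⊆T (proj₁ critT)) ⟩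
    ∣ T ∣ + ∣ N G T′ ∣                          ≡⟨ cong (λ k → k + ∣ N G T′ ∣) (≡-sym (∣p─q∣+∣p∩q∣≡∣p∣ T (N G B))) ⟩
    ∣ T′ ∣ + ∣ T ∩ N G B ∣ + ∣ N G T′ ∣         ≡⟨ solve 3 (λ a b c → a :+ b :+ c := a :+ c :+ b) refl
                                                          (∣ T′ ∣) (∣ T ∩ N G B ∣) (∣ N G T′ ∣) ⟩
    ∣ T′ ∣ + ∣ N G T′ ∣ + ∣ T ∩ N G B ∣         ∎)
    where
      open ≤-Reasoning
      open +-*-Solver
      T′ : Subset n
      T′ = T ─ N G B
      T′⊆T : T′ ⊆ T
      T′⊆T = p─q⊆p T (N G B)
      disjoint : ∀ {x} → x ∈ N G T′ → x ∈ B → Empty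
      disjoint x∈NT′ x∈B = let t , t∈T′ , tx = ∈N⁻ x∈NT′ in
        x∈p─q⇒x∉q T (N G B) t∈T′ (∈N⁺ x∈B (trans (Graph.sym G _ t) tx))
      NT′,B⊆NT : ∣ N G T′ ∣ + ∣ B ∣ ≤ ∣ N G T ∣
      NT′,B⊆NT = disjoint-⊆⇒∣p∣+∣q∣≤∣r∣ disjoint (N-mono T′⊆T) B⊆NT

  critical-∪ : ∀ {T I} → Critical G T → Independent G (T ∪ I) → T ≼ I → Critical G (T ∪ I)
  critical-∪ {T} {I} critT indT∪I T≼I =
    indT∪I , λ J indJ → ≼⇒d-≤ {J} {T ∪ I} (≼-trans (critical⇒≼ critT indJ) T≼T∪I)
    where
      T≼T∪I : T ≼ T ∪ I
      T≼T∪I = ≼-exchange (≼-trans (critical⇒≼ critT (⊆-independent (p∩q⊆p T I) (proj₁ critT))) T≼I)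

  -- A vertex
  -- u ∈ T′ outside T ∪ N(T) would lie in the core I of T ∪ T′, and T ∪ I would be a critical
  -- independent set larger than T.
  maxCrit-⊆-N : ∀ {T T′} → MaxCritIndep G T → MaxCritIndep G T′ →
    ∀ {u} → u ∈ T′ → u ∉ T → u ∈ N G T
  maxCrit-⊆-N {T} {T′} (critT , largestT) (critT′ , _) {u} u∈T′ u∉T with u ∈? N G T
  ... | yes u∈NT = u∈NT
  ... | no  u∉NT = ⊥-elim (<⇒≱ ∣T∣<∣T∪I∣ (largestT (T ∪ I) critT∪I))
    where
      Z I : Subset n
      Z = T ∪ T′
      I = core Z
      T≼I : T ≼ I
      T≼I = ≼-trans (≼-exchange (critical⇒≼ critT′ (⊆-independent (p∩q⊆p T T′) (proj₁ critT))))
                    (≼-core Z)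
      critT∪I : Critical G (T ∪ I)
      critT∪I = critical-∪ critT
        (∪-independent (proj₁ critT) (core-independent Z) (core-NoEdges (p⊆p∪q T′))) T≼I
      u∉NZ : u ∉ N G Z
      u∉NZ u∈NZ with ∈N⁻ u∈NZ
      ... | w , w∈Z , wu with x∈p∪q⁻ T T′ w∈Z
      ... | inj₁ w∈T  = u∉NT (∈N⁺ w∈T wu)
      ... | inj₂ w∈T′ = no-edge (proj₁ critT′ w u w∈T′ u∈T′) wu
      ∣T∣<∣T∪I∣ : ∣ T ∣ < ∣ T ∪ I ∣
      ∣T∣<∣T∪I∣ = p⊂q⇒∣p∣<∣q∣ (p⊆p∪q I , u , q⊆p∪q T I (x∈p∧x∉q⇒x∈p─q (q⊆p∪q T T′ u∈T′) u∉NZ) , u∉T)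

  -- If T is critical, X ⊆ T ⊆ Y, Y ─ T ⊆ N(T) and no vertex of X is adjacent to Y, then
  -- |X| + |Y| ≤ 2|T|: by Hall, |Y ─ T| ≤ |T ∩ N(Y ─ T)| ≤ |T ─ X|.
  critical-sandwich : ∀ {T X Y} → Critical G T → X ⊆ T → T ⊆ Y → Y ─ T ⊆ N G T → NoEdges X Y →
    ∣ X ∣ + ∣ Y ∣ ≤ ∣ T ∣ + ∣ T ∣
  critical-sandwich {T} {X} {Y} critT X⊆T T⊆Y B⊆NT noEdges = begin
    ∣ X ∣ + ∣ Y ∣               ≡⟨ cong (λ k → ∣ X ∣ + k) (≡-sym (∣q─p∣+∣p∣≡∣q∣ T⊆Y)) ⟩
    ∣ X ∣ + (∣ B ∣ + ∣ T ∣)     ≤⟨ +-monoʳ-≤ (∣ X ∣) (+-monoˡ-≤ (∣ T ∣) ∣B∣≤∣T─X∣) ⟩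
    ∣ X ∣ + (∣ T ─ X ∣ + ∣ T ∣) ≡⟨ solve 3 (λ a b c → a :+ (b :+ c) := (b :+ a) :+ c) refl
                                          (∣ X ∣) (∣ T ─ X ∣) (∣ T ∣) ⟩
    ∣ T ─ X ∣ + ∣ X ∣ + ∣ T ∣   ≡⟨ cong (λ k → k + ∣ T ∣) (∣q─p∣+∣p∣≡∣q∣ X⊆T) ⟩
    ∣ T ∣ + ∣ T ∣               ∎
    where
      open ≤-Reasoning
      open +-*-Solver
      B : Subset n
      B = Y ─ T
      T∩NB⊆T─X : T ∩ N G B ⊆ T ─ X
      T∩NB⊆T─X t∈T∩NB with x∈p∩q⁻ T (N G B) t∈T∩NB
      ... | t∈T , t∈NB with ∈N⁻ t∈NB
      ... | b , b∈B , bt = x∈p∧x∉q⇒x∈p─q t∈T λ t∈X →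
        no-edge (noEdges _ b t∈X (p─q⊆p Y T b∈B)) (trans (Graph.sym G _ b) bt)
      ∣B∣≤∣T─X∣ : ∣ B ∣ ≤ ∣ T ─ X ∣
      ∣B∣≤∣T─X∣ = ≤-trans (hall critT B⊆NT) (p⊆q⇒∣p∣≤∣q∣ T∩NB⊆T─X)

  -- Upper bound for a nonempty family of maximum critical sets T ∷ Γ: X = ⋂, Y = ⋃ satisfy
  -- the hypotheses of critical-sandwich by closure.
  maxCrit-family-bound : ∀ {T Γ} → All (MaxCritIndep G) (T ∷ Γ) →
    ∣ ⋂ (T ∷ Γ) ∣ + ∣ ⋃ (T ∷ Γ) ∣ ≤ ∣ T ∣ + ∣ T ∣
  maxCrit-family-bound {T} {Γ} maxCritΓ@(maxCritT All.∷ maxCritRest) =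
    critical-sandwich (proj₁ maxCritT) (p∩q⊆p T (⋂ Γ)) (p⊆p∪q (⋃ Γ)) ⋃─T⊆NT
      (⋂-⋃-NoEdges (All.map (proj₁ ∘ proj₁) maxCritΓ))
    where
      ⋃─T⊆NT : ⋃ (T ∷ Γ) ─ T ⊆ N G T
      ⋃─T⊆NT y∈⋃─T with x∈p∪q⁻ T (⋃ Γ) (p─q⊆p (⋃ (T ∷ Γ)) T y∈⋃─T)
      ... | inj₁ y∈T = ⊥-elim (x∈p─q⇒x∉q (⋃ (T ∷ Γ)) T y∈⋃─T y∈T)
      ... | inj₂ y∈⋃ = let maxCritS , y∈S = All.lookupAny maxCritRest (∈⋃⁻ Γ y∈⋃) in
        maxCrit-⊆-N maxCritT maxCritS y∈S (x∈p─q⇒x∉q (⋃ (T ∷ Γ)) T y∈⋃─T)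

  -- If T is maximum independent and X is independent with no neighbours in Y, then
  -- X ∪ (T ∩ Y) is independent, hence at most |T|; this gives |X| + |Y| ≤ |T ∩ X| + |T ∪ Y|.
  maximum-exchange : ∀ {T X Y} → MaximumIndependent G T → Independent G X → NoEdges X Y →
    ∣ X ∣ + ∣ Y ∣ ≤ ∣ T ∩ X ∣ + ∣ T ∪ Y ∣
  maximum-exchange {T} {X} {Y} (indT , largest) indX noEdges = +-cancelʳ-≤ (∣ T ∩ Y ∣) _ _ (begin
    ∣ X ∣ + ∣ Y ∣ + ∣ T ∩ Y ∣           ≡⟨ solve 3 (λ a b c → a :+ b :+ c := a :+ c :+ b) refl
                                                  (∣ X ∣) (∣ Y ∣) (∣ T ∩ Y ∣) ⟩
    ∣ X ∣ + ∣ T ∩ Y ∣ + ∣ Y ∣           ≤⟨ +-monoˡ-≤ (∣ Y ∣) ∣X∣+∣T∩Y∣≤∣T∣+∣T∩X∣ ⟩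
    ∣ T ∣ + ∣ T ∩ X ∣ + ∣ Y ∣           ≡⟨ solve 3 (λ a b c → a :+ b :+ c := b :+ (a :+ c)) refl
                                                  (∣ T ∣) (∣ T ∩ X ∣) (∣ Y ∣) ⟩
    ∣ T ∩ X ∣ + (∣ T ∣ + ∣ Y ∣)         ≡⟨ cong (λ k → ∣ T ∩ X ∣ + k) (≡-sym (∣p∪q∣+∣p∩q∣≡∣p∣+∣q∣ T Y)) ⟩
    ∣ T ∩ X ∣ + (∣ T ∪ Y ∣ + ∣ T ∩ Y ∣) ≡⟨ ≡-sym (+-assoc (∣ T ∩ X ∣) (∣ T ∪ Y ∣) (∣ T ∩ Y ∣)) ⟩
    ∣ T ∩ X ∣ + ∣ T ∪ Y ∣ + ∣ T ∩ Y ∣   ∎)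
    where
      open ≤-Reasoning
      open +-*-Solver
      W : Subset n
      W = X ∪ (T ∩ Y)
      indW : Independent G W
      indW = ∪-independent indX (⊆-independent (p∩q⊆p T Y) indT)
                           (NoEdges-⊆ (λ x∈X → x∈X) (p∩q⊆q T Y) noEdges)
      overlap⊆T∩X : X ∩ (T ∩ Y) ⊆ T ∩ X
      overlap⊆T∩X x∈ = let x∈X , x∈T∩Y = x∈p∩q⁻ X (T ∩ Y) x∈ in x∈p∩q⁺ (p∩q⊆p T Y x∈T∩Y , x∈X)
      ∣X∣+∣T∩Y∣≤∣T∣+∣T∩X∣ : ∣ X ∣ + ∣ T ∩ Y ∣ ≤ ∣ T ∣ + ∣ T ∩ X ∣
      ∣X∣+∣T∩Y∣≤∣T∣+∣T∩X∣ = begin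
        ∣ X ∣ + ∣ T ∩ Y ∣       ≡⟨ ≡-sym (∣p∪q∣+∣p∩q∣≡∣p∣+∣q∣ X (T ∩ Y)) ⟩
        ∣ W ∣ + ∣ X ∩ (T ∩ Y) ∣ ≤⟨ +-mono-≤ (largest W indW) (p⊆q⇒∣p∣≤∣q∣ overlap⊆T∩X) ⟩
        ∣ T ∣ + ∣ T ∩ X ∣       ∎

  α-maximum : ∀ {S} → MaximumIndependent G S → α G ≡ ∣ S ∣
  α-maximum {S} (indS , largest) = maxCard-attained (independent? G) S indS largest

  α′-maxCrit : ∀ {T} → MaxCritIndep G T → α′ G ≡ ∣ T ∣
  α′-maxCrit {T} (critT , largest) = maxCard-attained (critical? G) T critT largest

  α′≤α : α′ G ≤ α G
  α′≤α = maxCard-lub (critical? G) (α G) λ A critA → maxCard-ub (independent? G) A (proj₁ critA)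

  -- Lower bound for a nonempty family of maximum independent sets, adding one set at a time:
  -- ⋂ (T ∷ Γ) = T ∩ ⋂ Γ and ⋃ (T ∷ Γ) = T ∪ ⋃ Γ, so maximum-exchange is the induction step.
  maximum-family-bound : ∀ T Γ → All (MaximumIndependent G) (T ∷ Γ) →
    α G + α G ≤ ∣ ⋂ (T ∷ Γ) ∣ + ∣ ⋃ (T ∷ Γ) ∣
  maximum-family-bound T [] (maxT All.∷ All.[]) = ≤-reflexive (cong₂ _+_
    (trans (α-maximum maxT) (cong ∣_∣ (≡-sym (∩-identityʳ T))))
    (trans (α-maximum maxT) (cong ∣_∣ (≡-sym (∪-identityʳ T)))))
  maximum-family-bound T (S ∷ Γ) (maxT All.∷ maxΓ@(maxS All.∷ _)) =
    ≤-trans (maximum-family-bound S Γ maxΓ)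
            (maximum-exchange maxT (⊆-independent (p∩q⊆p S (⋂ Γ)) (proj₁ maxS))
                              (⋂-⋃-NoEdges (All.map proj₁ maxΓ)))

2*m≡m+m : ∀ m → 2 * m ≡ m + m
2*m≡m+m m = cong (λ k → m + k) (+-identityʳ m)

theorem2p3 : ∀ {n : ℕ} (G : Graph n) (Γ′ Γ : List (Subset n)) →
    Γ′ ≢ [] → All (MaxCritIndep G) Γ′ →
    Γ ≢ [] → All (MaximumIndependent G) Γ →
    (∣ ⋂ Γ′ ∣ + ∣ ⋃ Γ′ ∣ ≤ 2 * α′ G) × (2 * α′ G ≤ 2 * α G) × (2 * α G ≤ ∣ ⋂ Γ ∣ + ∣ ⋃ Γ ∣)
theorem2p3 G []       _       Γ′≢[] _ _    _ = ⊥-elim (Γ′≢[] refl)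
theorem2p3 G (_ ∷ _)  []      _     _ Γ≢[] _ = ⊥-elim (Γ≢[] refl)
theorem2p3 G (T ∷ Γ′) (S ∷ Γ) _ maxCritΓ′ _ maximumΓ = upper , *-monoʳ-≤ 2 (α′≤α G) , lower
  where
    open ≤-Reasoning
    α′≡∣T∣ : α′ G ≡ ∣ T ∣
    α′≡∣T∣ = α′-maxCrit G (All.head maxCritΓ′)
    upper : ∣ ⋂ (T ∷ Γ′) ∣ + ∣ ⋃ (T ∷ Γ′) ∣ ≤ 2 * α′ G
    upper = begin
      ∣ ⋂ (T ∷ Γ′) ∣ + ∣ ⋃ (T ∷ Γ′) ∣ ≤⟨ maxCrit-family-bound G maxCritΓ′ ⟩
      ∣ T ∣ + ∣ T ∣                   ≡⟨ cong₂ _+_ (≡-sym α′≡∣T∣) (≡-sym α′≡∣T∣) ⟩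
      α′ G + α′ G                     ≡⟨ ≡-sym (2*m≡m+m (α′ G)) ⟩
      2 * α′ G                        ∎
    lower : 2 * α G ≤ ∣ ⋂ (S ∷ Γ) ∣ + ∣ ⋃ (S ∷ Γ) ∣
    lower = begin
      2 * α G                         ≡⟨ 2*m≡m+m (α G) ⟩
      α G + α G                       ≤⟨ maximum-family-bound G S Γ maximumΓ ⟩
      ∣ ⋂ (S ∷ Γ) ∣ + ∣ ⋃ (S ∷ Γ) ∣   ∎
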